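{- Let $p$ be a prime and let $D$ be a finite set of positive integers. Set $m=\max\{\nu_p(d): d\in D\}$ and $N=p^{m+1}$. For each $d\in D$ let $F_d\subset \mathbb{Z}_p$. Suppose that $\sum_{d\in D_p(j)}|F_d|\le p-1$ for each $j=0,1,\ldots,m-1$, and $\sum_{d\in D_p(m)}|F_d|\le p-2$. Then there is an invertible element $\lambda\in\mathbb{Z}_N$ such that $q(\lambda d)\notin F_d$ for every $d\in D$.
   Context: For a positive integer $x$, $\nu_p(x)=\max\{k: p^k\mid x\}$. The $p$-levels of $D$ are $D_p(i)=\{d\in D:\nu_p(d)=i\}$. For an integer $x$, $q(x)\in\mathbb{Z}_p$ is the residue modulo $p$ of $\lfloor x/p^m\rfloor$; this depends only on $x$ modulo $N$, so for $\lambda\in\mathbb{Z}_N$ and $d\in D$, $q(\lambda d)$ is computed on the representative of $\lambda d$ in $\{0,1,\ldots,N-1\}$ (equivalently, $q(x)=k$ iff the residue of $x$ mod $N$ lies in $[kN/p,(k+1)N/p)$). -}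

module Defs where

open import Data.Nat using (ℕ; suc; _*_; _^_; _%_; _/_; NonZero)
open import Data.Nat.Properties using (m^n≢0; _≟_)
open import Data.Nat.DivMod using (_mod_)
open import Data.Nat.Divisibility using (_∣_)
open import Data.Nat.Primality using (Prime; prime⇒nonZero)
open import Data.Fin using (Fin)
open import Data.Fin.Subset using (Subset; ∣_∣)
open import Data.List using (List; map; filter)
open import Data.Nat.ListAction using (sum)
open import Data.Product using (_×_; ∃)
open import Relation.Binary.PropositionalEquality using (_≡_)
open import Relation.Nullary using (¬_)

modulus : ℕ → ℕ → ℕ
modulus p m = p ^ suc m

IsValuation : ℕ → ℕ → ℕ → Set
IsValuation p d k = (p ^ k ∣ d) × ¬ (p ^ suc k ∣ d)

q : (p m : ℕ) → Prime p → ℕ → Fin p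
q p m pp x =
  let instance _ = prime⇒nonZero pp
               _ = m^n≢0 p m
               _ = m^n≢0 p (suc m)
  in ((x % modulus p m) / (p ^ m)) mod p

levelSum : {p : ℕ} → (v : ℕ → ℕ) → (F : ℕ → Subset p) → List ℕ → ℕ → ℕ
levelSum v F D j = sum (map (λ d → ∣ F d ∣) (filter (λ d → v d ≟ j) D))

IsUnitMod : (p m : ℕ) → Prime p → ℕ → Set
IsUnitMod p m pp l =
  let instance _ = prime⇒nonZero pp
               _ = m^n≢0 p (suc m)
  in ∃ λ μ → (l * μ) % modulus p m ≡ 1 % modulus p m

module Submission where

-- Build λ digit by digit in base p, λ = c₀ + c₁ p + ⋯ + c_m p^m.
-- Write d = e · p^ν(d) with p ∤ e.  Adding the digit c · p^K to λ adds
-- c · e · p^(K + ν(d)) to λ d, so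
--   * if K + ν(d) > m the change is a multiple of N = p^(m+1) and q(λ d) is unchanged;
--   * if K + ν(d) = m, q(λ d) becomes (q₀ + c e) mod p, an injective function of c.
-- Hence after the digits c₀ … c_{K-1} are chosen, every d with ν(d) > m - K is
-- settled for good, and the digit c_K only has to dodge, for each d on level
-- m - K, at most |F_d| values.  The level hypotheses leave a free choice: p digits
-- against at most p - 1 forbidden ones, and for c₀ the p - 1 nonzero digits (which
-- make λ a unit) against at most p - 2.

open import Defs
open import Data.Nat using (ℕ; _*_; _%_; _≤_; _<_; _∸_)
open import Data.Nat.Primality using (Prime)
open import Data.Fin.Subset using (Subset; _∉_)
open import Data.List using (List)
open import Data.List.Membership.Propositional using (_∈_)
open import Data.List.Relation.Unary.Unique.Propositional using (Unique)
open import Data.Product using (Σ; ∃; _×_)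
open import Relation.Binary.PropositionalEquality using (_≡_)

open import Data.Nat using (zero; suc; nonTrivial⇒n>1; _+_; _^_; _/_; NonZero; z≤n; s≤s; s≤s⁻¹; z<s; >-nonZero)
open import Data.Nat.Properties
open import Data.Nat.DivMod
  using (_mod_; m≡m%n+[m/n]*n; %-remove-+ʳ; m%[n*o]/o≡m/o%n; m%n%n≡m%n;
         +-distrib-/-∣ʳ; m*n/n≡m; [m+kn]%n≡m%n)
open import Data.Nat.Divisibility
  using (_∣_; divides; >⇒∤; ∣m+n∣m⇒∣n; ∣n⇒∣m*n; m∣m*n; ∣-trans; ∣1⇒≡1)
open import Data.Nat.Primality using (prime⇒nonZero; prime⇒nonTrivial; prime⇒irreducible; euclidsLemma)
open import Data.Nat.Coprimality using (Coprime; coprime-Bézout; coprime-divisor)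
open import Data.Nat.GCD using (module Bézout)
open import Data.Nat.ListAction using (sum)
open import Data.Nat.Tactic.RingSolver using (solve-∀)
open import Data.Fin using (Fin; toℕ)
open import Data.Fin.Properties using (toℕ-fromℕ<)
open import Data.Fin.Subset using (∣_∣; _-_) renaming (_∈_ to _∈ˢ_)
open import Data.Fin.Subset.Properties using (_∈?_; x∈p⇒∣p-x∣<∣p∣; x∈p∧x≢y⇒x∈p-y)
open import Data.List using ([]; _∷_; _++_; length; map; filter; upTo)
open import Data.List.Properties using (length-++; length-map; length-upTo; filter-notAll)
open import Data.List.Membership.Propositional.Properties
  using (∈-++⁺ˡ; ∈-++⁺ʳ; ∈-filter⁺; ∈-filter⁻; ∈-upTo⁻; ∈-map⁻)
open import Data.List.Membership.DecPropositional _≟_ using () renaming (_∈?_ to _∈ᴸ?_)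
open import Data.List.Relation.Unary.Any using (here; there) renaming (map to any-map)
open import Data.List.Relation.Unary.All using () renaming (lookup to all-lookup)
open import Data.List.Relation.Unary.AllPairs using (_∷_)
open import Data.List.Relation.Unary.Unique.Propositional.Properties
  using (filter⁺; upTo⁺; map⁺)
open import Data.Product using (_,_; proj₁; proj₂)
open import Data.Sum using (inj₁; inj₂; [_,_]′)
open import Data.Empty using (⊥; ⊥-elim)
open import Relation.Nullary using (¬_; yes; no; ¬?)
open import Relation.Binary.PropositionalEquality
  using (_≢_; refl; sym; trans; cong; cong₂; subst; module ≡-Reasoning)
open import Relation.Binary.Definitions using (tri<; tri≈; tri>)

-- (1) Avoiding forbidden values

InjectiveOn : {B : Set} → (ℕ → B) → List ℕ → Set
InjectiveOn f L = ∀ {x y} → x ∈ L → y ∈ L → f x ≡ f y → x ≡ y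

injection-length≤ : ∀ {n} (f : ℕ → Fin n) {S : Subset n} {L : List ℕ} →
  Unique L → InjectiveOn f L → (∀ {x} → x ∈ L → f x ∈ˢ S) → length L ≤ ∣ S ∣
injection-length≤ f {L = []} _ _ _ = z≤n
injection-length≤ f {S} {x ∷ L} (x∉L ∷ uniq) inj into = begin
    suc (length L)   ≤⟨ s≤s (injection-length≤ f uniq (λ y z → inj (there y) (there z)) into-rest) ⟩
    suc ∣ S - f x ∣  ≤⟨ x∈p⇒∣p-x∣<∣p∣ (into (here refl)) ⟩
    ∣ S ∣            ∎
  where
  open ≤-Reasoning
  into-rest : ∀ {y} → y ∈ L → f y ∈ˢ S - f x
  into-rest y∈L = x∈p∧x≢y⇒x∈p-y (into (there y∈L))
    (λ fy≡fx → all-lookup x∉L y∈L (inj (here refl) (there y∈L) (sym fy≡fx)))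

hitting : ∀ {n} → (ℕ → Fin n) → Subset n → List ℕ → List ℕ
hitting f S = filter (λ c → f c ∈? S)

blocked : ∀ {n} {A : Set} → (A → ℕ → Fin n) → (A → Subset n) → List A → List ℕ → List ℕ
blocked f S []       C = []
blocked f S (d ∷ ds) C = hitting (f d) (S d) C ++ blocked f S ds C

blocked-length≤ : ∀ {n} {A : Set} (f : A → ℕ → Fin n) (S : A → Subset n) ds {C} →
  Unique C → (∀ {d} → d ∈ ds → InjectiveOn (f d) C) →
  length (blocked f S ds C) ≤ sum (map (λ d → ∣ S d ∣) ds)
blocked-length≤ f S []       _    _   = z≤n
blocked-length≤ f S (d ∷ ds) {C} uniq inj =
  subst (_≤ _) (sym (length-++ (hitting (f d) (S d) C)))
    (+-mono-≤ hitting-bound (blocked-length≤ f S ds uniq (λ d'∈ds → inj (there d'∈ds))))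
  where
  P? = λ c → f d c ∈? S d
  hitting-bound : length (hitting (f d) (S d) C) ≤ ∣ S d ∣
  hitting-bound = injection-length≤ (f d) (filter⁺ P? uniq)
    (λ x y → inj (here refl) (proj₁ (∈-filter⁻ P? {xs = C} x)) (proj₁ (∈-filter⁻ P? {xs = C} y)))
    (λ x → proj₂ (∈-filter⁻ P? {xs = C} x))

blocked-complete : ∀ {n} {A : Set} (f : A → ℕ → Fin n) (S : A → Subset n) {ds C d c} →
  d ∈ ds → c ∈ C → f d c ∈ˢ S d → c ∈ blocked f S ds C
blocked-complete f S {d' ∷ _} (here refl) c∈C hit = ∈-++⁺ˡ (∈-filter⁺ (λ c → f d' c ∈? S d') c∈C hit)
blocked-complete f S {d' ∷ _} {C} (there d∈ds) c∈C hit =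
  ∈-++⁺ʳ (hitting (f d') (S d') C) (blocked-complete f S d∈ds c∈C hit)

remove : ℕ → List ℕ → List ℕ
remove c = filter (λ x → ¬? (x ≟ c))

remove-shorter : ∀ {c L} → c ∈ L → length (remove c L) < length L
remove-shorter {c} {L} c∈L = filter-notAll (λ x → ¬? (x ≟ c)) L (any-map (λ eq ne → ne (sym eq)) c∈L)

remove-keeps : ∀ {c x L} → x ∈ L → x ≢ c → x ∈ remove c L
remove-keeps {c} = ∈-filter⁺ (λ x → ¬? (x ≟ c))

outside : ∀ {C} (L : List ℕ) → Unique C → length L < length C → ∃ λ c → c ∈ C × ¬ c ∈ L
outside {c ∷ C} L (c∉C ∷ uniq) len with c ∈ᴸ? L
... | no c∉L = c , here refl , c∉L
... | yes c∈L with c' , c'∈C , c'∉L' ← outside (remove c L) uniq (<-≤-trans (remove-shorter c∈L) (s≤s⁻¹ len)) =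
  c' , there c'∈C , λ c'∈L → c'∉L' (remove-keeps c'∈L (λ c'≡c → all-lookup c∉C c'∈C (sym c'≡c)))

avoid : ∀ {n} {A : Set} (f : A → ℕ → Fin n) (S : A → Subset n) (ds : List A) {C} →
  Unique C → (∀ {d} → d ∈ ds → InjectiveOn (f d) C) →
  sum (map (λ d → ∣ S d ∣) ds) < length C →
  ∃ λ c → c ∈ C × (∀ {d} → d ∈ ds → f d c ∉ S d)
avoid f S ds uniq inj small
  with c , c∈C , c∉B ← outside (blocked f S ds _) uniq (≤-<-trans (blocked-length≤ f S ds uniq inj) small)
  = c , c∈C , λ d∈ds hit → c∉B (blocked-complete f S d∈ds c∈C hit)

-- (2) Arithmetic of q under adding a digit

%-invariant⇒∣ : ∀ n .{{_ : NonZero n}} x y → (x + y) % n ≡ x % n → n ∣ y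
%-invariant⇒∣ n x y h = divides ((x + y) / n ∸ x / n) (begin
    y                                                     ≡⟨ sym (m+n∸m≡n x y) ⟩
    (x + y) ∸ x                                           ≡⟨ cong₂ _∸_ (m≡m%n+[m/n]*n (x + y) n) (m≡m%n+[m/n]*n x n) ⟩
    ((x + y) % n + (x + y) / n * n) ∸ (x % n + x / n * n) ≡⟨ cong (λ z → (z + (x + y) / n * n) ∸ (x % n + x / n * n)) h ⟩
    (x % n + (x + y) / n * n) ∸ (x % n + x / n * n)       ≡⟨ [m+n]∸[m+o]≡n∸o (x % n) _ _ ⟩
    (x + y) / n * n ∸ x / n * n                           ≡⟨ sym (*-distribʳ-∸ n ((x + y) / n) (x / n)) ⟩
    ((x + y) / n ∸ x / n) * n                             ∎)
  where open ≡-Reasoning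

^-mono-∣ : ∀ p {a b} → a ≤ b → p ^ a ∣ p ^ b
^-mono-∣ p {a} {b} a≤b = subst (λ t → p ^ a ∣ p ^ t) (m+[n∸m]≡n a≤b)
  (subst (p ^ a ∣_) (sym (^-distribˡ-+-* p a (b ∸ a))) (m∣m*n (p ^ (b ∸ a))))

digit-expansion : ∀ p r c e k j →
  (r + c * p ^ k) * (e * p ^ j) ≡ r * (e * p ^ j) + c * e * p ^ (k + j)
digit-expansion p r c e k j rewrite ^-distribˡ-+-* p k j = ring r c (p ^ k) e (p ^ j)
  where
  ring : ∀ r c a e b → (r + c * a) * (e * b) ≡ r * (e * b) + c * e * (a * b)
  ring = solve-∀

digit-bound : ∀ {p r c} K → r < p ^ K → c < p → r + c * p ^ K < p ^ suc K
digit-bound {p} {r} {c} K r<pᴷ c<p = <-≤-trans (+-monoˡ-< (c * p ^ K) r<pᴷ) (*-monoˡ-≤ (p ^ K) c<p)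

module ModPrime (p : ℕ) (pp : Prime p) where
  instance
    p≢0 : NonZero p
    p≢0 = prime⇒nonZero pp

  residues-differ : ∀ B e {a b} → ¬ p ∣ e → a < b → b < p →
    (B + a * e) % p ≡ (B + b * e) % p → ⊥
  residues-differ B e {a} {b} p∤e a<b b<p h = [ p∤b∸a , p∤e ]′ (euclidsLemma (b ∸ a) e pp p∣difference)
    where
    open ≡-Reasoning
    split : B + a * e + (b ∸ a) * e ≡ B + b * e
    split = begin
      B + a * e + (b ∸ a) * e   ≡⟨ +-assoc B _ _ ⟩
      B + (a * e + (b ∸ a) * e) ≡⟨ cong (B +_) (sym (*-distribʳ-+ e a (b ∸ a))) ⟩
      B + (a + (b ∸ a)) * e     ≡⟨ cong (λ z → B + z * e) (m+[n∸m]≡n (<⇒≤ a<b)) ⟩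
      B + b * e                 ∎
    p∣difference : p ∣ (b ∸ a) * e
    p∣difference = %-invariant⇒∣ p (B + a * e) _ (trans (cong (_% p) split) (sym h))
    p∤b∸a : ¬ p ∣ b ∸ a
    p∤b∸a = >⇒∤ {{>-nonZero (m<n⇒0<n∸m a<b)}} (≤-<-trans (m∸n≤m b a) b<p)

  affine-injective : ∀ B e {c₁ c₂} → ¬ p ∣ e → c₁ < p → c₂ < p →
    (B + c₁ * e) % p ≡ (B + c₂ * e) % p → c₁ ≡ c₂
  affine-injective B e {c₁} {c₂} p∤e c₁<p c₂<p h with <-cmp c₁ c₂
  ... | tri< lt _ _ = ⊥-elim (residues-differ B e p∤e lt c₂<p h)
  ... | tri≈ _ eq _ = eq
  ... | tri> _ _ gt = ⊥-elim (residues-differ B e p∤e gt c₁<p (sym h))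

module Digits (p : ℕ) (pp : Prime p) (m : ℕ) where
  open ModPrime p pp
  instance
    p^m≢0 : NonZero (p ^ m)
    p^m≢0 = m^n≢0 p m
    N≢0 : NonZero (p ^ suc m)
    N≢0 = m^n≢0 p (suc m)

  q-toℕ : ∀ x → toℕ (q p m pp x) ≡ x / p ^ m % p
  q-toℕ x = trans (toℕ-fromℕ< _)
    (trans (cong (_% p) (m%[n*o]/o≡m/o%n x p (p ^ m))) (m%n%n≡m%n (x / p ^ m) p))

  q-periodic : ∀ x y → p ^ suc m ∣ y → q p m pp (x + y) ≡ q p m pp x
  q-periodic x y N∣y = cong (λ z → (z / p ^ m) mod p) (%-remove-+ʳ x N∣y)

  q-add : ∀ x c → toℕ (q p m pp (x + c * p ^ m)) ≡ (x / p ^ m + c) % p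
  q-add x c = trans (q-toℕ (x + c * p ^ m)) (cong (_% p)
    (trans (+-distrib-/-∣ʳ x (divides c refl)) (cong (x / p ^ m +_) (m*n/n≡m c (p ^ m)))))

  q-add-injective : ∀ x e {c₁ c₂} → ¬ p ∣ e → c₁ < p → c₂ < p →
    q p m pp (x + c₁ * e * p ^ m) ≡ q p m pp (x + c₂ * e * p ^ m) → c₁ ≡ c₂
  q-add-injective x e {c₁} {c₂} p∤e c₁<p c₂<p h =
    affine-injective (x / p ^ m) e p∤e c₁<p c₂<p (begin
      (x / p ^ m + c₁ * e) % p           ≡⟨ sym (q-add x (c₁ * e)) ⟩
      toℕ (q p m pp (x + c₁ * e * p ^ m)) ≡⟨ cong toℕ h ⟩
      toℕ (q p m pp (x + c₂ * e * p ^ m)) ≡⟨ q-add x (c₂ * e) ⟩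
      (x / p ^ m + c₂ * e) % p           ∎)
    where open ≡-Reasoning

-- (3) Units modulo p^(m+1)

coprime-^ : ∀ {r n} k → Coprime r n → Coprime r (n ^ k)
coprime-^ zero    _   (_ , i∣1) = ∣1⇒≡1 i∣1
coprime-^ {r} {n} (suc k) r⊥n {i} (i∣r , i∣n*nᵏ) = coprime-^ k r⊥n (i∣r , coprime-divisor i⊥n i∣n*nᵏ)
  where
  i⊥n : Coprime i n
  i⊥n (j∣i , j∣n) = r⊥n (∣-trans j∣i i∣r , j∣n)

coprime⇒invertible : ∀ n r .{{_ : NonZero n}} → Coprime r n → ∃ λ μ → (r * μ) % n ≡ 1 % n
coprime⇒invertible n@(suc n-1) r r⊥n with coprime-Bézout r⊥n
... | Bézout.+- x y 1+yn≡xr = x , trans (cong (_% n) (trans (*-comm r x) (sym 1+yn≡xr))) ([m+kn]%n≡m%n 1 y n)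
... | Bézout.-+ x y 1+xr≡yn = x * n-1 , (begin
      (r * (x * n-1)) % n         ≡⟨ sym ([m+kn]%n≡m%n (r * (x * n-1)) 1 n) ⟩
      (r * (x * n-1) + 1 * n) % n ≡⟨ cong (_% n) rearrange ⟩
      (1 + (y * n-1) * n) % n     ≡⟨ [m+kn]%n≡m%n 1 (y * n-1) n ⟩
      1 % n                        ∎)
  where
  open ≡-Reasoning
  -- r (x (n-1)) + n = (1 + x r)(n-1) + 1 = y n (n-1) + 1
  ring₁ : ∀ r x k → r * (x * k) + 1 * suc k ≡ (1 + x * r) * k + 1
  ring₁ = solve-∀
  ring₂ : ∀ y k → y * suc k * k + 1 ≡ 1 + y * k * suc k
  ring₂ = solve-∀
  rearrange : r * (x * n-1) + 1 * n ≡ 1 + (y * n-1) * n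
  rearrange = trans (ring₁ r x n-1) (trans (cong (λ z → z * n-1 + 1) 1+xr≡yn) (ring₂ y n-1))

prime∤⇒coprime : ∀ {p r} → Prime p → ¬ p ∣ r → Coprime r p
prime∤⇒coprime pp p∤r (j∣r , j∣p) with prime⇒irreducible pp j∣p
... | inj₁ j≡1 = j≡1
... | inj₂ refl = ⊥-elim (p∤r j∣r)

unit-mod : ∀ p m (pp : Prime p) r → ¬ p ∣ r → IsUnitMod p m pp r
unit-mod p m pp r p∤r =
  coprime⇒invertible (p ^ suc m) r {{m^n≢0 p (suc m) {{prime⇒nonZero pp}}}} (coprime-^ (suc m) (prime∤⇒coprime pp p∤r))

-- (4) The digit-by-digit construction

module Construction (p : ℕ) (pp : Prime p) (m : ℕ) (D : List ℕ) (v : ℕ → ℕ)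
    (valuation : ∀ d → d ∈ D → IsValuation p d (v d)) (F : ℕ → Subset p) where
  open Digits p pp m

  Good : ℕ → ℕ → Set
  Good l d = q p m pp (l * d) ∉ F d

  Settled : ℕ → ℕ → Set
  Settled K l = ∀ d → d ∈ D → m < v d + K → Good l d

  unit-part : ∀ {d} → d ∈ D → ∃ λ e → d ≡ e * p ^ v d × ¬ p ∣ e
  unit-part {d} d∈D with divides e d≡e*pᵛ , pᵛ⁺¹∤d ← valuation d d∈D =
    e , d≡e*pᵛ , λ { (divides f e≡f*p) → pᵛ⁺¹∤d (divides f (begin
      d                   ≡⟨ d≡e*pᵛ ⟩
      e * p ^ v d         ≡⟨ cong (_* p ^ v d) e≡f*p ⟩
      f * p * p ^ v d     ≡⟨ *-assoc f p (p ^ v d) ⟩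
      f * p ^ suc (v d)   ∎)) }
    where open ≡-Reasoning

  add-digit : ∀ {d e} → d ≡ e * p ^ v d → ∀ r c K →
    (r + c * p ^ K) * d ≡ r * d + c * e * p ^ (K + v d)
  add-digit {d} {e} d≡e*pᵛ r c K = begin
    (r + c * p ^ K) * d                       ≡⟨ cong ((r + c * p ^ K) *_) d≡e*pᵛ ⟩
    (r + c * p ^ K) * (e * p ^ v d)           ≡⟨ digit-expansion p r c e K (v d) ⟩
    r * (e * p ^ v d) + c * e * p ^ (K + v d) ≡⟨ cong (λ z → r * z + c * e * p ^ (K + v d)) (sym d≡e*pᵛ) ⟩
    r * d + c * e * p ^ (K + v d)             ∎
    where open ≡-Reasoning

  higher-digit-irrelevant : ∀ {d} → d ∈ D → ∀ r c K → m < v d + K →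
    q p m pp ((r + c * p ^ K) * d) ≡ q p m pp (r * d)
  higher-digit-irrelevant {d} d∈D r c K m<v+K with e , d≡e*pᵛ , _ ← unit-part d∈D =
    trans (cong (q p m pp) (add-digit d≡e*pᵛ r c K))
      (q-periodic (r * d) _ (∣n⇒∣m*n (c * e) (^-mono-∣ p (subst (m <_) (+-comm (v d) K) m<v+K))))

  level-digit-injective : ∀ {d} → d ∈ D → ∀ r K → v d + K ≡ m → ∀ {c₁ c₂} → c₁ < p → c₂ < p →
    q p m pp ((r + c₁ * p ^ K) * d) ≡ q p m pp ((r + c₂ * p ^ K) * d) → c₁ ≡ c₂
  level-digit-injective {d} d∈D r K v+K≡m {c₁} {c₂} c₁<p c₂<p h
    with e , d≡e*pᵛ , p∤e ← unit-part d∈D =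
    q-add-injective (r * d) e p∤e c₁<p c₂<p (begin
      q p m pp (r * d + c₁ * e * p ^ m)         ≡⟨ cong (λ t → q p m pp (r * d + c₁ * e * p ^ t)) K+v≡m ⟨
      q p m pp (r * d + c₁ * e * p ^ (K + v d)) ≡⟨ cong (q p m pp) (add-digit d≡e*pᵛ r c₁ K) ⟨
      q p m pp ((r + c₁ * p ^ K) * d)           ≡⟨ h ⟩
      q p m pp ((r + c₂ * p ^ K) * d)           ≡⟨ cong (q p m pp) (add-digit d≡e*pᵛ r c₂ K) ⟩
      q p m pp (r * d + c₂ * e * p ^ (K + v d)) ≡⟨ cong (λ t → q p m pp (r * d + c₂ * e * p ^ t)) K+v≡m ⟩
      q p m pp (r * d + c₂ * e * p ^ m)         ∎)
    where
    open ≡-Reasoning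
    K+v≡m : K + v d ≡ m
    K+v≡m = trans (+-comm K (v d)) v+K≡m

  Level : ℕ → List ℕ
  Level j = filter (λ d → v d ≟ j) D

  on-level : ∀ {K d} → K ≤ m → d ∈ Level (m ∸ K) → d ∈ D × v d + K ≡ m
  on-level {K} {d} K≤m d∈L with d∈D , v≡m∸K ← ∈-filter⁻ (λ d → v d ≟ m ∸ K) d∈L =
    d∈D , trans (cong (_+ K) v≡m∸K) (m∸n+n≡m K≤m)

  next-digit : ∀ K → K ≤ m → ∀ r → Settled K r →
    (C : List ℕ) → Unique C → (∀ {c} → c ∈ C → c < p) → levelSum v F D (m ∸ K) < length C →
    ∃ λ c → c ∈ C × Settled (suc K) (r + c * p ^ K)
  next-digit K K≤m r settled C uniq C<p small
    with c , c∈C , avoids ← avoid (λ d c → q p m pp ((r + c * p ^ K) * d)) F (Level (m ∸ K)) uniq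
           (λ d∈L c₁∈C c₂∈C → level-digit-injective (proj₁ (on-level K≤m d∈L)) r K
              (proj₂ (on-level K≤m d∈L)) (C<p c₁∈C) (C<p c₂∈C)) small
    = c , c∈C , settles
    where
    settles : Settled (suc K) (r + c * p ^ K)
    settles d d∈D m<v+1+K with m <? v d + K
    ... | yes m<v+K = λ hit → settled d d∈D m<v+K
                        (subst (_∈ˢ F d) (higher-digit-irrelevant d∈D r c K m<v+K) hit)
    ... | no m≮v+K = avoids (∈-filter⁺ (λ d → v d ≟ m ∸ K) d∈D
                       (trans (sym (m+n∸n≡m (v d) K)) (cong (_∸ K) v+K≡m)))
      where
      v+K≡m : v d + K ≡ m
      v+K≡m = ≤-antisym (≮⇒≥ m≮v+K) (m<1+n⇒m≤n (subst (m <_) (+-suc (v d) K) m<v+1+K))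

  module Build (below-m : ∀ d → d ∈ D → v d ≤ m)
               (lower-levels : ∀ j → j < m → levelSum v F D j ≤ p ∸ 1)
               (top-level : levelSum v F D m ≤ p ∸ 2) where

    1<p : 1 < p
    1<p = nonTrivial⇒n>1 p {{prime⇒nonTrivial pp}}

    nonzero-digits : List ℕ
    nonzero-digits = map suc (upTo (p ∸ 1))

    nonzero-digit : ∀ {c} → c ∈ nonzero-digits → 0 < c × c < p
    nonzero-digit c∈ with i , i∈ , refl ← ∈-map⁻ suc c∈ =
      z<s , subst (suc (suc i) ≤_) (m+[n∸m]≡n (<⇒≤ 1<p)) (s≤s (∈-upTo⁻ i∈))

    Partial : ℕ → Set
    Partial K = Σ ℕ λ l → l < p ^ suc K × ¬ p ∣ l × Settled (suc K) l

    nothing-to-settle : Settled 0 0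
    nothing-to-settle d d∈D m<v+0 = ⊥-elim (<⇒≱ (subst (m <_) (+-identityʳ (v d)) m<v+0) (below-m d d∈D))

    top-room : levelSum v F D m < length nonzero-digits
    top-room = subst (levelSum v F D m <_) (sym (trans (length-map suc (upTo (p ∸ 1))) (length-upTo (p ∸ 1))))
      (≤-<-trans top-level (∸-monoʳ-< (n<1+n 1) 1<p))

    lower-room : ∀ K → suc K ≤ m → levelSum v F D (m ∸ suc K) < length (upTo p)
    lower-room K K<m = subst (levelSum v F D (m ∸ suc K) <_) (sym (length-upTo p))
      (≤-<-trans (lower-levels (m ∸ suc K) (∸-monoʳ-< z<s K<m)) (∸-monoʳ-< z<s (<⇒≤ 1<p)))

    first-digit : Partial 0
    first-digit with c , c∈ , settled ← next-digit 0 z≤n 0 nothing-to-settle nonzero-digits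
                        (map⁺ suc-injective (upTo⁺ (p ∸ 1))) (λ c∈ → proj₂ (nonzero-digit c∈)) top-room =
      0 + c * 1 , digit-bound 0 z<s (proj₂ (nonzero-digit c∈)) , p∤c , settled
      where
      p∤c : ¬ p ∣ 0 + c * 1
      p∤c = subst (λ x → ¬ p ∣ x) (sym (*-identityʳ c))
        (>⇒∤ {{>-nonZero (proj₁ (nonzero-digit c∈))}} (proj₂ (nonzero-digit c∈)))

    -- Every further digit may be arbitrary; p ∤ λ persists since p divides c p^(K+1).
    later-digit : ∀ K → suc K ≤ m → Partial K → Partial (suc K)
    later-digit K K<m (r , r< , p∤r , settled)
      with c , c∈ , settled′ ← next-digit (suc K) K<m r settled (upTo p) (upTo⁺ p) ∈-upTo⁻
             (lower-room K K<m) =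
      r + c * p ^ suc K , digit-bound (suc K) r< (∈-upTo⁻ c∈) , p∤r+cpᴷ , settled′
      where
      p∤r+cpᴷ : ¬ p ∣ r + c * p ^ suc K
      p∤r+cpᴷ p∣ = p∤r (∣m+n∣m⇒∣n (subst (p ∣_) (+-comm r _) p∣) (∣n⇒∣m*n c (m∣m*n (p ^ K))))

    construct : ∀ K → K ≤ m → Partial K
    construct zero    _   = first-digit
    construct (suc K) K<m = later-digit K K<m (construct K (<⇒≤ K<m))

    solution : Σ ℕ λ l → l < modulus p m × IsUnitMod p m pp l × (∀ d → d ∈ D → q p m pp (l * d) ∉ F d)
    solution with l , l< , p∤l , settled ← construct m ≤-refl =
      l , l< , unit-mod p m pp l p∤l , λ d d∈D → settled d d∈D (<-≤-trans (n<1+n m) (m≤n+m (suc m) (v d)))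

lemma1 : (p : ℕ) (pp : Prime p) (D : List ℕ) → Unique D → (∀ d → d ∈ D → 0 < d) →
    (v : ℕ → ℕ) → (∀ d → d ∈ D → IsValuation p d (v d)) →
    (m : ℕ) → (∀ d → d ∈ D → v d ≤ m) → (∃ λ d → d ∈ D × v d ≡ m) →
    (F : ℕ → Subset p) →
    (∀ j → j < m → levelSum v F D j ≤ p ∸ 1) →
    levelSum v F D m ≤ p ∸ 2 →
    Σ ℕ (λ l → l < modulus p m × IsUnitMod p m pp l ×
      (∀ d → d ∈ D → q p m pp (l * d) ∉ F d))
lemma1 p pp D _ _ v valuation m below-m _ F lower-levels top-level =
  Construction.Build.solution p pp m D v valuation F below-m lower-levels top-level
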